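{- Let $G=(U,V,E)$ be a bipartite graph, $F\subseteq E$, and let $(E_r,E_b)$ be an $(A,B,C)$-free bipartition of the set $E_c$ of committed edges of $G$. Let $G-F=(U,V,E\setminus F)$. Then there is no alternating cycle of $E_r$ relative to $G-F$.
   Context: Let $\hat{E}=\{uv: u\in U, v\in V, uv\notin E\}$. Two edges $u_1v_1,u_2v_2\in E$ are in conflict in $G$ if $u_1v_2,u_2v_1\in\hat{E}$. An edge is committed if it is in conflict with some other edge of $E$. A bipartition of $E_c$ is a pair $(E_r,E_b)$ partitioning $E_c$ with $F\cap E_c\subseteq E_b$ (so $E_r\subseteq E\setminus F$). Forbidden configurations on vertices $u_1,u_2\in U$, $v_1,v_2\in V$: $(A_1)$: $u_1v_1,u_2v_2\in E_r$, $u_1v_2,u_2v_1\in\hat{E}$; $(A_2)$: $u_1v_1,u_2v_2\in E_b$, $u_1v_2,u_2v_1\in\hat{E}$; $(B_1)$: $u_1v_1,u_2v_2\in E_r$, $u_1v_2\in\hat{E}$, $u_2v_1\in E_b$; $(B_2)$: $u_1v_1,u_2v_2\in E_b$, $u_1v_2\in\hat{E}$, $u_2v_1\in E_r$; $(C)$: $u_1v_1,u_2v_2\in E_r$, $u_1v_2\in\hat{E}$, $u_2v_1\in F$. The bipartition is $(A,B,C)$-free if it contains none of these five. For a bipartite graph $H=(U,V,E_H)$ and $M\subseteq E_H$, and $k\ge2$, an alternating cycle of $M$ relative to $H$ consists of distinct $u_0,\dots,u_{k-1}\in U$ and distinct $v_0,\dots,v_{k-1}\in V$ with $u_iv_i\notin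 E_H$ and $u_{i+1}v_i\in M$ for all $0\le i<k$ (indices modulo $k$). -}

module Defs where

open import Data.Nat using (ℕ; suc; _%_; NonZero)
open import Data.Nat.DivMod using (m%n<n)
open import Data.Fin using (Fin; toℕ; fromℕ<)
open import Data.Product using (_×_; Σ; ∃; ∃-syntax; _,_)
open import Data.Sum using (_⊎_)
open import Relation.Nullary using (¬_)
open import Relation.Binary.PropositionalEquality using (_≡_; _≢_)
open import Function.Definitions using (Injective)

EdgeSet : ℕ → ℕ → Set₁
EdgeSet m n = Fin m → Fin n → Set

module _ {m n : ℕ} where

  NonEdge : EdgeSet m n → EdgeSet m n
  NonEdge E u v = ¬ E u v

  InConflict : EdgeSet m n → Fin m → Fin n → Fin m → Fin n → Set
  InConflict E u₁ v₁ u₂ v₂ =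
    E u₁ v₁ × E u₂ v₂ × NonEdge E u₁ v₂ × NonEdge E u₂ v₁

  Committed : EdgeSet m n → EdgeSet m n
  Committed E u v =
    E u v × ∃[ u' ] ∃[ v' ] (((u ≢ u') ⊎ (v ≢ v')) × InConflict E u v u' v')

  IsBipartition : (E F Er Eb : EdgeSet m n) → Set
  IsBipartition E F Er Eb =
    (∀ u v → Er u v → Committed E u v) ×
    (∀ u v → Eb u v → Committed E u v) ×
    (∀ u v → Committed E u v → Er u v ⊎ Eb u v) ×
    (∀ u v → Er u v → ¬ Eb u v) ×
    (∀ u v → F u v → Committed E u v → Eb u v)

  A₁ A₂ B₁ B₂ C : (E F Er Eb : EdgeSet m n) → Fin m → Fin m → Fin n → Fin n → Set
  A₁ E F Er Eb u₁ u₂ v₁ v₂ = Er u₁ v₁ × Er u₂ v₂ × NonEdge E u₁ v₂ × NonEdge E u₂ v₁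
  A₂ E F Er Eb u₁ u₂ v₁ v₂ = Eb u₁ v₁ × Eb u₂ v₂ × NonEdge E u₁ v₂ × NonEdge E u₂ v₁
  B₁ E F Er Eb u₁ u₂ v₁ v₂ = Er u₁ v₁ × Er u₂ v₂ × NonEdge E u₁ v₂ × Eb u₂ v₁
  B₂ E F Er Eb u₁ u₂ v₁ v₂ = Eb u₁ v₁ × Eb u₂ v₂ × NonEdge E u₁ v₂ × Er u₂ v₁
  C  E F Er Eb u₁ u₂ v₁ v₂ = Er u₁ v₁ × Er u₂ v₂ × NonEdge E u₁ v₂ × F u₂ v₁

  ABCFree : (E F Er Eb : EdgeSet m n) → Set
  ABCFree E F Er Eb = ∀ u₁ u₂ v₁ v₂ →
    ¬ A₁ E F Er Eb u₁ u₂ v₁ v₂ × ¬ A₂ E F Er Eb u₁ u₂ v₁ v₂ ×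
    ¬ B₁ E F Er Eb u₁ u₂ v₁ v₂ × ¬ B₂ E F Er Eb u₁ u₂ v₁ v₂ ×
    ¬ C E F Er Eb u₁ u₂ v₁ v₂

  Minus : EdgeSet m n → EdgeSet m n → EdgeSet m n
  Minus E F u v = E u v × ¬ F u v

next : {k : ℕ} → .{{_ : NonZero k}} → Fin k → Fin k
next {k} i = fromℕ< (m%n<n (suc (toℕ i)) k)

-- alternating cycle of M relative to H = (U,V,E_H), of length k = 2 + j ≥ 2;
-- indices are Fin k and i+1 is taken modulo k (via `next`).
record AlternatingCycle {m n : ℕ} (H M : EdgeSet m n) : Set where
  field
    j      : ℕ
    us     : Fin (suc (suc j)) → Fin m
    vs     : Fin (suc (suc j)) → Fin n
    us-inj : Injective _≡_ _≡_ us
    vs-inj : Injective _≡_ _≡_ vs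
    notH   : ∀ i → ¬ H (us i) (vs i)
    inM    : ∀ i → M (us (next i)) (vs i)

-- Write H = G − F. A detour from a to y is a path a v, b v, b y with a v and
-- b y red and b v ∉ H. Every red edge lies in H, and so does the chord a y of a
-- detour (detour⇒¬¬H). Two consecutive detours from a to y can be replaced by
-- the red edge a y or by a single detour (twoDetours-shortcut). Along an
-- alternating cycle u_{i+1} v_i is red and u_i v_i ∉ H, so starting from the red
-- edge u₁ v₀ and prepending these steps one at a time always leaves a red edge
-- or a detour from u_i to v₀; after a full turn i = 0, which forces u₀ v₀ ∈ H. Case splits on undecidable edge predicates happen inside
-- ¬ ¬, which is harmless for a negative goal.
module Submission where

open import Defs
open import Data.Nat using (ℕ; zero; suc; _+_; _%_)
open import Data.Nat.DivMod using (m%n<n; %-distribˡ-+; m%n%n≡m%n; n%n≡0)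
open import Data.Fin using (Fin; toℕ) renaming (zero to fzero)
open import Data.Fin.Properties using (toℕ-fromℕ<; toℕ-injective)
open import Data.Product using (_×_; ∃₂; _,_; proj₁; proj₂)
open import Data.Sum using (inj₁; inj₂)
open import Data.Empty using (⊥; ⊥-elim)
open import Function using (_∘_)
open import Relation.Nullary using (¬_)
open import Relation.Binary.PropositionalEquality using (_≡_; refl; trans; cong; subst; module ≡-Reasoning)

module ABCFreeBipartition {m n : ℕ} (E F Er Eb : EdgeSet m n)
  (F⊆E : ∀ u v → F u v → E u v)
  (bip : IsBipartition E F Er Eb)
  (free : ABCFree E F Er Eb) where

  private variable
    a b c : Fin m
    v w y : Fin n

  H : EdgeSet m n
  H = Minus E F

  red⇒committed : Er a v → Committed E a v
  red⇒committed = proj₁ bip _ _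

  blue⇒E : Eb a v → E a v
  blue⇒E = proj₁ ∘ proj₁ (proj₂ bip) _ _

  red⇒¬blue : Er a v → ¬ Eb a v
  red⇒¬blue = proj₁ (proj₂ (proj₂ (proj₂ bip))) _ _

  committed∧¬red⇒blue : Committed E a v → ¬ Er a v → Eb a v
  committed∧¬red⇒blue k ¬r with proj₁ (proj₂ (proj₂ bip)) _ _ k
  ... | inj₁ r  = ⊥-elim (¬r r)
  ... | inj₂ bl = bl

  red⇒H : Er a v → H a v
  red⇒H r = proj₁ (red⇒committed r) ,
            λ f → red⇒¬blue r (proj₂ (proj₂ (proj₂ (proj₂ bip))) _ _ f (red⇒committed r))

  F⇒¬red : F a v → ¬ Er a v
  F⇒¬red f r = proj₂ (red⇒H r) f

  A₁-free : Er a v → Er b y → ¬ E a y → ¬ E b v → ⊥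
  A₁-free r r′ ¬e ¬e′ = proj₁ (free _ _ _ _) (r , r′ , ¬e , ¬e′)

  A₂-free : Eb a v → Eb b y → ¬ E a y → ¬ E b v → ⊥
  A₂-free bl bl′ ¬e ¬e′ = proj₁ (proj₂ (free _ _ _ _)) (bl , bl′ , ¬e , ¬e′)

  B₂-free : Eb a v → Eb b y → ¬ E a y → Er b v → ⊥
  B₂-free bl bl′ ¬e r = proj₁ (proj₂ (proj₂ (proj₂ (free _ _ _ _)))) (bl , bl′ , ¬e , r)

  C-free : Er a v → Er b y → ¬ E a y → F b v → ⊥
  C-free r r′ ¬e f = proj₂ (proj₂ (proj₂ (proj₂ (free _ _ _ _)))) (r , r′ , ¬e , f)

  conflict⇒committed : E a v → E b y → ¬ E a y → ¬ E b v → Committed E a v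
  conflict⇒committed {a = a} {b = b} {y = y} eav eby ¬eay ¬ebv =
    eav , b , y , inj₂ (λ v≡y → ¬eay (subst (E a) v≡y eav)) , eav , eby , ¬eay , ¬ebv

  conflict∧¬red⇒blue : E a v → E b y → ¬ E a y → ¬ E b v → ¬ Er a v → Eb a v
  conflict∧¬red⇒blue eav eby ¬eay ¬ebv =
    committed∧¬red⇒blue (conflict⇒committed eav eby ¬eay ¬ebv)

  red-red⇒¬¬H : Er a v → Er b y → ¬ E a y → ¬ ¬ H b v
  red-red⇒¬¬H r r′ ¬eay ¬hbv = A₁-free r r′ ¬eay λ ebv → ¬hbv (ebv , C-free r r′ ¬eay)

  nonRed∧blue⇒¬¬E : E a v → ¬ Er a v → Eb b y → ¬ E b v → ¬ ¬ E a y
  nonRed∧blue⇒¬¬E eav ¬rav bby ¬ebv ¬eay =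
    A₂-free bby (conflict∧¬red⇒blue eav (blue⇒E bby) ¬eay ¬ebv ¬rav) ¬ebv ¬eay

  BluePartner : Fin m → Fin n → Set
  BluePartner a v = ∃₂ λ p q → Eb p q × ¬ E a q × ¬ E p v

  red⇒bluePartner : Er a v → BluePartner a v
  red⇒bluePartner rav with red⇒committed rav
  ... | eav , p , q , _ , _ , epq , ¬eaq , ¬epv =
    p , q , conflict∧¬red⇒blue epq eav ¬epv ¬eaq (λ rpq → A₁-free rav rpq ¬eaq ¬epv) , ¬eaq , ¬epv

  red-red-F-square : Er a v → Er b y → F a y → F b v → ⊥
  red-red-F-square {a = a} {b = b} rav rby fay fbv
    with red⇒bluePartner rav | red⇒bluePartner rby
  ... | p , q , bpq , ¬eaq , ¬epv | x , z , bxz , ¬ebz , ¬exy =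
    ¬¬eaz λ eaz → ¬¬ebq λ ebq →
      A₂-free (conflict∧¬red⇒blue eaz ebq ¬eaq ¬ebz (λ raz → C-free rby raz ¬ebz fay))
              (conflict∧¬red⇒blue ebq eaz ¬ebz ¬eaq (λ rbq → C-free rav rbq ¬eaq fbv))
              ¬eaq ¬ebz
    where
    ¬¬eaz : ¬ ¬ E a z
    ¬¬eaz = nonRed∧blue⇒¬¬E (F⊆E _ _ fay) (F⇒¬red fay) bxz ¬exy
    ¬¬ebq : ¬ ¬ E b q
    ¬¬ebq = nonRed∧blue⇒¬¬E (F⊆E _ _ fbv) (F⇒¬red fbv) bpq ¬epv

  detour⇒¬¬H : Er a v → ¬ H b v → Er b y → ¬ ¬ H a y
  detour⇒¬¬H {a = a} {v = v} {b = b} {y = y} rav ¬hbv rby ¬hay =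
    red-red⇒¬¬H rav rby (λ eay → ¬hay (eay , ¬fay)) ¬hbv
    where
    ¬fay : ¬ F a y
    ¬fay fay = C-free rby rav ¬ebv fay
      where ¬ebv : ¬ E b v
            ¬ebv ebv = ¬hbv (ebv , red-red-F-square rav rby fay)

  twoDetours⇒¬¬E : Er a w → ¬ H b w → Er b v → ¬ H c v → Er c y → ¬ ¬ E a y
  twoDetours⇒¬¬E {a = a} {b = b} {v = v} {y = y} raw ¬hbw rbv ¬hcv rcy ¬eay
    with red⇒bluePartner rbv
  ... | p , q , bpq , ¬ebq , ¬epv =
    detour⇒¬¬H raw ¬hbw rbv λ (eav , _) →
    detour⇒¬¬H rbv ¬hcv rcy λ (eby , _) →
    nonRed∧blue⇒¬¬E eav ¬rav bpq ¬epv λ eaq →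
    let bby = conflict∧¬red⇒blue eby eaq ¬ebq ¬eay ¬rby in
    A₂-free bby bpq ¬ebq λ epy →
    B₂-free (conflict∧¬red⇒blue eav epy ¬eay ¬epv ¬rav) bby ¬eay rbv
    where
    ¬rav : ¬ Er a v
    ¬rav rav = red-red⇒¬¬H rav rcy ¬eay ¬hcv
    ¬rby : ¬ Er b y
    ¬rby rby = red-red⇒¬¬H raw rby ¬eay ¬hbw

  twoDetours-shortcut : Er a w → ¬ H b w → Er b v → ¬ H c v → Er c y → E c w → ¬ ¬ Er a y
  twoDetours-shortcut {a = a} {w = w} {c = c} {y = y} raw ¬hbw rbv ¬hcv rcy ecw ¬ray
    with red⇒bluePartner raw | red⇒bluePartner rcy
  -- a y is committed since it conflicts with x q, which mixes the two blue partners
  ... | p , q , bpq , ¬eaq , ¬epw | x , z , bxz , ¬ecz , ¬exy =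
    twoDetours⇒¬¬E raw ¬hbw rbv ¬hcv rcy λ eay →
    ¬¬exw λ exw →
    nonRed∧blue⇒¬¬E exw ¬rxw bpq ¬epw λ exq →
    ¬bay exw (committed∧¬red⇒blue (conflict⇒committed eay exq ¬eaq ¬exy) ¬ray)
    where
    ¬rcw : ¬ Er c w
    ¬rcw rcw = detour⇒¬¬H rbv ¬hcv rcw ¬hbw
    ¬¬exw : ¬ ¬ E x w
    ¬¬exw ¬exw = nonRed∧blue⇒¬¬E ecw ¬rcw bxz ¬exw ¬ecz
    ¬rxw : ¬ Er x w
    ¬rxw rxw = twoDetours⇒¬¬E rxw ¬hbw rbv ¬hcv rcy ¬exy
    ¬bay : E x w → ¬ Eb a y
    ¬bay exw bay = A₂-free bay bpq ¬eaq λ epy →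
      B₂-free (conflict∧¬red⇒blue exw epy ¬exy ¬epw ¬rxw) bay ¬exy raw

  data ShortRedPath (a : Fin m) (y : Fin n) : Set where
    direct : Er a y → ShortRedPath a y
    detour : Er a v → ¬ H b v → Er b y → ShortRedPath a y

  shortRedPath⇒¬¬H : ShortRedPath a y → ¬ ¬ H a y
  shortRedPath⇒¬¬H (direct r)          ¬h = ¬h (red⇒H r)
  shortRedPath⇒¬¬H (detour r ¬h′ r′) ¬h = detour⇒¬¬H r ¬h′ r′ ¬h

  prependDetour : Er a w → ¬ H b w → ShortRedPath b y → ¬ ¬ ShortRedPath a y
  prependDetour raw ¬hbw (direct rby) k = k (detour raw ¬hbw rby)
  prependDetour raw ¬hbw (detour rbv ¬hcv rcy) k =
    k (detour raw (λ (ecw , _) → twoDetours-shortcut raw ¬hbw rbv ¬hcv rcy ecw (k ∘ direct)) rcy)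

next^_ : {k : ℕ} → ℕ → Fin (suc k)
next^ zero    = fzero
next^ (suc t) = next (next^ t)

toℕ-next^ : (k t : ℕ) → toℕ (next^_ {k} t) ≡ t % suc k
toℕ-next^ k zero    = refl
toℕ-next^ k (suc t) = begin
  toℕ (next (next^ t))                    ≡⟨ toℕ-fromℕ< (m%n<n (suc (toℕ (next^_ {k} t))) (suc k)) ⟩
  (1 + toℕ (next^_ {k} t)) % suc k        ≡⟨ cong (λ i → (1 + i) % suc k) (toℕ-next^ k t) ⟩
  (1 + t % suc k) % suc k                 ≡⟨ %-distribˡ-+ 1 (t % suc k) (suc k) ⟩
  (1 % suc k + t % suc k % suc k) % suc k ≡⟨ cong (λ i → (1 % suc k + i) % suc k) (m%n%n≡m%n t (suc k)) ⟩
  (1 % suc k + t % suc k) % suc k         ≡⟨ %-distribˡ-+ 1 t (suc k) ⟨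
  suc t % suc k                           ∎
  where open ≡-Reasoning

next^-returns : (k : ℕ) → next^_ {k} (suc k) ≡ fzero
next^-returns k = toℕ-injective (trans (toℕ-next^ k (suc k)) (n%n≡0 (suc k)))

lemma6 : {m n : ℕ} (E F Er Eb : EdgeSet m n) →
    (∀ u v → F u v → E u v) →
    IsBipartition E F Er Eb →
    ABCFree E F Er Eb →
    ¬ AlternatingCycle (Minus E F) Er
lemma6 E F Er Eb F⊆E bip free cycle =
  pathToStart (suc j) λ path →
    shortRedPath⇒¬¬H (subst (λ i → ShortRedPath (us i) (vs fzero)) (next^-returns (suc j)) path)
                     (notH fzero)
  where
  open ABCFreeBipartition E F Er Eb F⊆E bip free
  open AlternatingCycle cycle
  pathToStart : ∀ t → ¬ ¬ ShortRedPath (us (next^ suc t)) (vs fzero)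
  pathToStart zero    k = k (direct (inM fzero))
  pathToStart (suc t) k = pathToStart t λ path → prependDetour (inM _) (notH _) path k
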